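{- Let $\rho\in S_s$ be a kernel permutation, let $\pi\in S(\rho)$, and let $1\leq k\leq s$, so that $\pi(i_k)$ is the $k$-th kernel entry of $\pi$. Then every cell $C_{ml}$ with $l>k$ and $m>\rho(k)$ is infeasible.
   Context: Patterns. An occurrence of $132$ in $\pi\in S_n$ is a triple of positions $i<j<k$ with $\pi(i)<\pi(k)<\pi(j)$. The graph $G_\pi$. $G_\pi$ is the bipartite graph whose vertices are the entries of $\pi$ and the occurrences of $132$ in $\pi$. An entry is adjacent to an occurrence exactly when it is one of the three entries of that occurrence. Kernel. Let $\pi(i_1),\dots,\pi(i_s)$, with $i_1<\dots<i_s$, be the entries in the component of $G_\pi$ containing $n$. This is the kernel of $\pi$, and the permutation $\sigma_\pi\in S_s$ order-isomorphic to it is the kernel shape. Kernel permutations. $\rho$ is a kernel permutation if $\rho=\sigma_\pi$ for some $\pi$. $S(\rho)$ is the set of all permutations, of all lengths, with kernel shape $\rho$. Cells. For $\pi\in S(\rho)\cap S_n$, set $i_0=0$, $i_{s+1}=n+1$, and interpret $\pi(i_{\rho^{ -1}(0)})$ as $0$. For $1\leq m\leq s$ and $1\leq l\leq s+1$, define $$C_{ml}(\pi)=\{\pi(j): i_{l-1}<j<i_l,\ \pi(i_{\rho^{ -1}(m-1)})<\pi(j)<\pi(i_{\rho^{ -1}(m)})\}.$$ Feasibility. The cell $C_{ml}$ is infeasible if, in $(\rho(1),\dots,\rho(l-1),m-\tfrac12,\rho(l),\dots,\rho(s))$, the inserted entry $m-\tfrac12$ belongs to some occurrence of $132$. Equivalently,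 any entry of a permutation in $S(\rho)$ lying in that cell would form an occurrence of $132$ together with two kernel entries. Otherwise the cell is feasible. -}

module Defs where

open import Data.Nat using (ℕ; zero; suc; _+_; _*_; _∸_; _≤_; _<_; _<ᵇ_; _≡ᵇ_)
open import Data.Bool using (if_then_else_)
open import Data.Product using (Σ; ∃; _×_; _,_)
open import Data.Sum using (_⊎_)
open import Relation.Binary.PropositionalEquality using (_≡_)
open import Relation.Binary.Construct.Closure.ReflexiveTransitive using (Star)

-- Conventions: permutations are 1-indexed functions ℕ → ℕ; only the
-- values at positions 1..n matter.  π ∈ S_n means π maps {1..n}
-- injectively (hence bijectively) into {1..n}.
IsPerm : ℕ → (ℕ → ℕ) → Set
IsPerm n π =
  (∀ i → 1 ≤ i → i ≤ n → (1 ≤ π i) × (π i ≤ n)) ×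
  (∀ i j → 1 ≤ i → i ≤ n → 1 ≤ j → j ≤ n → π i ≡ π j → i ≡ j)

Occ132 : ℕ → (ℕ → ℕ) → ℕ → ℕ → ℕ → Set
Occ132 n π i j k =
  (1 ≤ i) × (i < j) × (j < k) × (k ≤ n) × (π i < π k) × (π k < π j)

OneOf : ℕ → ℕ → ℕ → ℕ → Set
OneOf p i j k = (p ≡ i) ⊎ (p ≡ j) ⊎ (p ≡ k)

-- Entries at positions a and b are at distance ≤ 2 in G_π
-- (both belong to a common occurrence of 132).
Shares : ℕ → (ℕ → ℕ) → ℕ → ℕ → Set
Shares n π a b =
  Σ ℕ λ i → Σ ℕ λ j → Σ ℕ λ k →
    Occ132 n π i j k × OneOf a i j k × OneOf b i j k

-- Position p carries an entry of the component of G_π containing n.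
InKernel : ℕ → (ℕ → ℕ) → ℕ → Set
InKernel n π p =
  Σ ℕ λ t → (1 ≤ t) × (t ≤ n) × (π t ≡ n) × Star (Shares n π) t p

-- The kernel shape of π ∈ S_n is ρ ∈ S_s: the kernel positions are
-- i_1 < … < i_s (given by f) and ρ is order-isomorphic to π(i_1) … π(i_s).
KernelShape : ℕ → (ℕ → ℕ) → ℕ → (ℕ → ℕ) → Set
KernelShape n π s ρ =
  IsPerm s ρ ×
  Σ (ℕ → ℕ) λ f →
    (∀ a b → 1 ≤ a → a < b → b ≤ s → f a < f b) ×
    (∀ a → 1 ≤ a → a ≤ s → InKernel n π (f a)) ×
    (∀ p → InKernel n π p → Σ ℕ λ a → (1 ≤ a) × (a ≤ s) × (f a ≡ p)) ×
    (∀ a b → 1 ≤ a → a ≤ s → 1 ≤ b → b ≤ s →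
       ((ρ a < ρ b → π (f a) < π (f b)) × (π (f a) < π (f b) → ρ a < ρ b)))

IsKernelPerm : ℕ → (ℕ → ℕ) → Set
IsKernelPerm s ρ = Σ ℕ λ n → Σ (ℕ → ℕ) λ π → IsPerm n π × KernelShape n π s ρ

-- The sequence (ρ(1),…,ρ(l-1), m-1/2, ρ(l),…,ρ(s)) of length s+1,
-- with all values doubled to avoid halves: 2ρ(·) and 2m-1.
Insert : (ℕ → ℕ) → ℕ → ℕ → (ℕ → ℕ)
Insert ρ m l p =
  if p <ᵇ l then 2 * ρ p
  else (if p ≡ᵇ l then 2 * m ∸ 1 else 2 * ρ (p ∸ 1))

Infeasible : ℕ → (ℕ → ℕ) → ℕ → ℕ → Set
Infeasible s ρ m l =
  Σ ℕ λ i → Σ ℕ λ j → Σ ℕ λ k →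
    Occ132 (suc s) (Insert ρ m l) i j k × OneOf l i j k

-- Call a kernel index a lower if a < l and ρ(a) < m.  If the cell C_ml were
-- feasible, no occurrence of 132 in ρ could mix lower and non-lower indices:
-- otherwise the value m - 1/2 inserted at position l would complete an
-- occurrence of 132 with two of its entries.  The kernel is connected through
-- occurrences of 132, so its indices would be all lower or all non-lower.  But
-- the index of the entry n has ρ-value s ≥ m, so it is not lower, while k < l and
-- ρ(k) < m make k lower.
module Submission where

open import Defs
open import Data.Nat using (ℕ; suc; _+_; _≤_; _<_; _*_; _∸_; _<ᵇ_; _≡ᵇ_; z≤n; s≤s; _<?_)
open import Data.Nat.Properties
open import Data.Bool using (true; false; T)
open import Data.Bool.Properties using (T-≡)
open import Data.Fin using (Fin; toℕ; fromℕ<)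
open import Data.Fin.Properties using (injective⇒≤; toℕ-fromℕ<; toℕ-injective; toℕ<n)
open import Data.Product using (Σ; _×_; _,_; proj₁; proj₂)
open import Data.Sum using (_⊎_; inj₁; inj₂; map₂)
open import Data.Empty using (⊥-elim)
open import Function.Bundles using (Equivalence)
open import Relation.Nullary using (¬_; yes; no; contradiction)
open import Relation.Binary.Definitions using (tri<; tri≈; tri>)
open import Relation.Binary.PropositionalEquality
open import Relation.Binary.Construct.Closure.ReflexiveTransitive using (Star; ε; _◅_; _◅◅_)

<ᵇ-true : ∀ {m n} → m < n → (m <ᵇ n) ≡ true
<ᵇ-true m<n = Equivalence.to T-≡ (<⇒<ᵇ m<n)

<ᵇ-false : ∀ {m n} → n ≤ m → (m <ᵇ n) ≡ false
<ᵇ-false {m} {n} n≤m with m <ᵇ n in eq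
... | false = refl
... | true  = contradiction (<ᵇ⇒< m n (subst T (sym eq) _)) (≤⇒≯ n≤m)

≡ᵇ-refl : ∀ n → (n ≡ᵇ n) ≡ true
≡ᵇ-refl n = Equivalence.to T-≡ (≡⇒≡ᵇ n n refl)

≡ᵇ-false : ∀ {m n} → m ≢ n → (m ≡ᵇ n) ≡ false
≡ᵇ-false {m} {n} m≢n with m ≡ᵇ n in eq
... | false = refl
... | true  = contradiction (≡ᵇ⇒≡ m n (subst T (sym eq) _)) m≢n

module _ (ρ : ℕ → ℕ) (m l : ℕ) where

  Insert-below : ∀ {p} → p < l → Insert ρ m l p ≡ 2 * ρ p
  Insert-below p<l rewrite <ᵇ-true p<l = refl

  Insert-at : Insert ρ m l l ≡ 2 * m ∸ 1
  Insert-at rewrite <ᵇ-false (≤-refl {l}) | ≡ᵇ-refl l = refl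

  Insert-above : ∀ {p} → l ≤ p → Insert ρ m l (suc p) ≡ 2 * ρ p
  Insert-above l≤p rewrite <ᵇ-false (m≤n⇒m≤1+n l≤p) | ≡ᵇ-false (>⇒≢ (s≤s l≤p)) = refl

double-<-double∸1 : ∀ {x m} → x < m → 2 * x < 2 * m ∸ 1
double-<-double∸1 {x} x<m =
  ≤-trans (≤-reflexive (sym (+-suc x (x + 0)))) (∸-monoˡ-≤ 1 (*-monoʳ-≤ 2 x<m))

double∸1-<-double : ∀ {m y} → 1 ≤ m → m ≤ y → 2 * m ∸ 1 < 2 * y
double∸1-<-double {suc _} _ m≤y = <-≤-trans (n<1+n _) (*-monoʳ-≤ 2 m≤y)

oneOf-elim : ∀ {P : ℕ → Set} {i j k x} → P i → P j → P k → OneOf x i j k → P x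
oneOf-elim Pi Pj Pk (inj₁ refl)        = Pi
oneOf-elim Pi Pj Pk (inj₂ (inj₁ refl)) = Pj
oneOf-elim Pi Pj Pk (inj₂ (inj₂ refl)) = Pk

Occ132-inRange : ∀ {n π i j k x} → Occ132 n π i j k → OneOf x i j k → (1 ≤ x) × (x ≤ n)
Occ132-inRange (1≤i , i<j , j<k , k≤n , _) =
  oneOf-elim (1≤i , ≤-trans (<⇒≤ (<-trans i<j j<k)) k≤n)
             (≤-trans 1≤i (<⇒≤ i<j) , ≤-trans (<⇒≤ j<k) k≤n)
             (≤-trans 1≤i (<⇒≤ (<-trans i<j j<k)) , k≤n)

InKernel-inRange : ∀ {n π p} → InKernel n π p → (1 ≤ p) × (p ≤ n)
InKernel-inRange (_ , 1≤t , t≤n , _ , t⇝p) = go 1≤t t≤n t⇝p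
  where
  go : ∀ {n π u p} → 1 ≤ u → u ≤ n → Star (Shares n π) u p → (1 ≤ p) × (p ≤ n)
  go 1≤u u≤n ε = 1≤u , u≤n
  go _ _ ((_ , _ , _ , occ , _ , ov) ◅ v⇝p) =
    let 1≤v , v≤n = Occ132-inRange occ ov in go 1≤v v≤n v⇝p

InKernel-step : ∀ {n π u v} → InKernel n π u → Shares n π u v → InKernel n π v
InKernel-step (t , 1≤t , t≤n , πt≡n , t⇝u) u~v = t , 1≤t , t≤n , πt≡n , (t⇝u ◅◅ u~v ◅ ε)

injectiveOn⇒≤ : ∀ {s c} (g : ℕ → ℕ) →
  (∀ b → 1 ≤ b → b ≤ s → (1 ≤ g b) × (g b ≤ c)) →
  (∀ a b → 1 ≤ a → a ≤ s → 1 ≤ b → b ≤ s → g a ≡ g b → a ≡ b) →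
  s ≤ c
injectiveOn⇒≤ {s} {c} g range injective = injective⇒≤ {f = h} h-injective
  where
  range′ : (i : Fin s) → (1 ≤ g (suc (toℕ i))) × (g (suc (toℕ i)) ≤ c)
  range′ i = range (suc (toℕ i)) (s≤s z≤n) (toℕ<n i)

  h : Fin s → Fin c
  h i = let 1≤gi , gi≤c = range′ i in fromℕ< (≤-trans (≤-reflexive (m+[n∸m]≡n 1≤gi)) gi≤c)

  h-injective : ∀ {i j} → h i ≡ h j → i ≡ j
  h-injective {i} {j} hi≡hj = toℕ-injective (suc-injective
    (injective _ _ (s≤s z≤n) (toℕ<n i) (s≤s z≤n) (toℕ<n j)
      (∸-cancelʳ-≡ (proj₁ (range′ i)) (proj₁ (range′ j))
        (trans (sym (toℕ-fromℕ< _)) (trans (cong toℕ hi≡hj) (toℕ-fromℕ< _))))))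

IsPerm-max : ∀ {s ρ a} → IsPerm s ρ → 1 ≤ a → a ≤ s →
  (∀ b → 1 ≤ b → b ≤ s → ρ b ≤ ρ a) → s ≤ ρ a
IsPerm-max (range , injective) 1≤a a≤s maximal =
  injectiveOn⇒≤ _ (λ b 1≤b b≤s → proj₁ (range b 1≤b b≤s) , maximal b 1≤b b≤s) injective

-- In infeasible-as-r the inserted entry 2m - 1 plays the role of r in the pattern 132.
module Cell (s : ℕ) (ρ : ℕ → ℕ) (m l : ℕ) (1≤m : 1 ≤ m) (1≤l : 1 ≤ l) (l≤1+s : l ≤ suc s) where

  Lower : ℕ → Set
  Lower a = (a < l) × (ρ a < m)

  infeasible-as-1 : ∀ {j k} → l ≤ j → j < k → k ≤ s → m ≤ ρ k → ρ k < ρ j → Infeasible s ρ m l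
  infeasible-as-1 {j} {k} l≤j j<k k≤s m≤ρk ρk<ρj =
    l , suc j , suc k ,
    (1≤l , s≤s l≤j , s≤s j<k , s≤s k≤s ,
     subst₂ _<_ (sym (Insert-at ρ m l)) (sym (Insert-above ρ m l l≤k)) (double∸1-<-double 1≤m m≤ρk) ,
     subst₂ _<_ (sym (Insert-above ρ m l l≤k)) (sym (Insert-above ρ m l l≤j)) (*-monoʳ-< 2 ρk<ρj)) ,
    inj₁ refl
    where l≤k = ≤-trans l≤j (<⇒≤ j<k)

  infeasible-as-3 : ∀ {i k} → 1 ≤ i → i < l → l ≤ k → k ≤ s → ρ i < ρ k → ρ k < m → Infeasible s ρ m l
  infeasible-as-3 {i} {k} 1≤i i<l l≤k k≤s ρi<ρk ρk<m =
    i , l , suc k ,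
    (1≤i , i<l , s≤s l≤k , s≤s k≤s ,
     subst₂ _<_ (sym (Insert-below ρ m l i<l)) (sym (Insert-above ρ m l l≤k)) (*-monoʳ-< 2 ρi<ρk) ,
     subst₂ _<_ (sym (Insert-above ρ m l l≤k)) (sym (Insert-at ρ m l)) (double-<-double∸1 ρk<m)) ,
    inj₂ (inj₁ refl)

  infeasible-as-2 : ∀ {i j} → 1 ≤ i → i < j → j < l → ρ i < m → m ≤ ρ j → Infeasible s ρ m l
  infeasible-as-2 {i} {j} 1≤i i<j j<l ρi<m m≤ρj =
    i , j , l ,
    (1≤i , i<j , j<l , l≤1+s ,
     subst₂ _<_ (sym (Insert-below ρ m l (<-trans i<j j<l))) (sym (Insert-at ρ m l)) (double-<-double∸1 ρi<m) ,
     subst₂ _<_ (sym (Insert-at ρ m l)) (sym (Insert-below ρ m l j<l)) (double∸1-<-double 1≤m m≤ρj)) ,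
    inj₂ (inj₂ refl)

  ¬Lower-right : ∀ {a b} → ¬ a < l → a ≤ b → ¬ Lower b
  ¬Lower-right a≮l a≤b (b<l , _) = a≮l (≤-<-trans a≤b b<l)

  ¬Lower-above : ∀ {a b} → ¬ ρ a < m → ρ a ≤ ρ b → ¬ Lower b
  ¬Lower-above ρa≮m ρa≤ρb (_ , ρb<m) = ρa≮m (≤-<-trans ρa≤ρb ρb<m)

  Occ132-from-Lower : ∀ {i j k} → Occ132 s ρ i j k → Lower i →
    Infeasible s ρ m l ⊎ (Lower i × Lower j × Lower k)
  Occ132-from-Lower {i} {j} {k} (1≤i , i<j , j<k , k≤s , ρi<ρk , ρk<ρj) (i<l , ρi<m)
    with j <? l | ρ j <? m | k <? l | ρ k <? m
  ... | yes j<l | no ρj≮m  | _       | _ = inj₁ (infeasible-as-2 1≤i i<j j<l ρi<m (≮⇒≥ ρj≮m))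
  ... | yes j<l | yes ρj<m | yes k<l | _ =
    inj₂ ((i<l , ρi<m) , (j<l , ρj<m) , (k<l , <-trans ρk<ρj ρj<m))
  ... | yes j<l | yes ρj<m | no k≮l  | _ =
    inj₁ (infeasible-as-3 1≤i i<l (≮⇒≥ k≮l) k≤s ρi<ρk (<-trans ρk<ρj ρj<m))
  ... | no j≮l  | _        | _       | yes ρk<m =
    inj₁ (infeasible-as-3 1≤i i<l (≤-trans (≮⇒≥ j≮l) (<⇒≤ j<k)) k≤s ρi<ρk ρk<m)
  ... | no j≮l  | _        | _       | no ρk≮m =
    inj₁ (infeasible-as-1 (≮⇒≥ j≮l) j<k k≤s (≮⇒≥ ρk≮m) ρk<ρj)

  Occ132-infeasible-or-uniform : ∀ {i j k} → Occ132 s ρ i j k →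
    Infeasible s ρ m l ⊎ ((Lower i × Lower j × Lower k) ⊎ (¬ Lower i × ¬ Lower j × ¬ Lower k))
  Occ132-infeasible-or-uniform {i} occ@(_ , i<j , j<k , _ , ρi<ρk , ρk<ρj) with i <? l | ρ i <? m
  ... | no i≮l | _ = inj₂ (inj₂
    (¬Lower-right i≮l ≤-refl , ¬Lower-right i≮l (<⇒≤ i<j) , ¬Lower-right i≮l (<⇒≤ (<-trans i<j j<k))))
  ... | yes _ | no ρi≮m = inj₂ (inj₂
    (¬Lower-above ρi≮m ≤-refl , ¬Lower-above ρi≮m (<⇒≤ (<-trans ρi<ρk ρk<ρj)) , ¬Lower-above ρi≮m (<⇒≤ ρi<ρk)))
  ... | yes i<l | yes ρi<m = map₂ inj₁ (Occ132-from-Lower occ (i<l , ρi<m))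

module Kernel {n s : ℕ} {π ρ : ℕ → ℕ} (π-perm : IsPerm n π) (ρ-perm : IsPerm s ρ) (f : ℕ → ℕ)
  (f-mono : ∀ a b → 1 ≤ a → a < b → b ≤ s → f a < f b)
  (f-kernel : ∀ a → 1 ≤ a → a ≤ s → InKernel n π (f a))
  (f-onto : ∀ p → InKernel n π p → Σ ℕ λ a → (1 ≤ a) × (a ≤ s) × (f a ≡ p))
  (f-iso : ∀ a b → 1 ≤ a → a ≤ s → 1 ≤ b → b ≤ s →
             ((ρ a < ρ b → π (f a) < π (f b)) × (π (f a) < π (f b) → ρ a < ρ b)))
  where

  f-injective : ∀ {a b} → 1 ≤ a → a ≤ s → 1 ≤ b → b ≤ s → f a ≡ f b → a ≡ b
  f-injective {a} {b} 1≤a a≤s 1≤b b≤s fa≡fb with <-cmp a b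
  ... | tri< a<b _ _ = contradiction fa≡fb (<⇒≢ (f-mono a b 1≤a a<b b≤s))
  ... | tri≈ _ a≡b _ = a≡b
  ... | tri> _ _ b<a = contradiction fa≡fb (>⇒≢ (f-mono b a 1≤b b<a a≤s))

  f-cancel-< : ∀ {a b} → 1 ≤ a → a ≤ s → 1 ≤ b → b ≤ s → f a < f b → a < b
  f-cancel-< {a} {b} 1≤a a≤s 1≤b b≤s fa<fb with <-cmp a b
  ... | tri< a<b _ _ = a<b
  ... | tri≈ _ refl _ = contradiction fa<fb (<-irrefl refl)
  ... | tri> _ _ b<a = contradiction fa<fb (<-asym (f-mono b a 1≤b b<a a≤s))

  Occ132-kernelIndices : ∀ {i j k} → Occ132 n π i j k →
    InKernel n π i → InKernel n π j → InKernel n π k →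
    Σ ℕ λ a → Σ ℕ λ b → Σ ℕ λ c → (f a ≡ i) × (f b ≡ j) × (f c ≡ k) × Occ132 s ρ a b c
  Occ132-kernelIndices (_ , i<j , j<k , _ , πi<πk , πk<πj) κi κj κk
    with f-onto _ κi | f-onto _ κj | f-onto _ κk
  ... | a , 1≤a , a≤s , refl | b , 1≤b , b≤s , refl | c , 1≤c , c≤s , refl =
    a , b , c , refl , refl , refl ,
    (1≤a , f-cancel-< 1≤a a≤s 1≤b b≤s i<j , f-cancel-< 1≤b b≤s 1≤c c≤s j<k , c≤s ,
     proj₂ (f-iso a c 1≤a a≤s 1≤c c≤s) πi<πk , proj₂ (f-iso c b 1≤c c≤s 1≤b b≤s) πk<πj)

  module _ (m l : ℕ) (1≤m : 1 ≤ m) (m≤s : m ≤ s) (1≤l : 1 ≤ l) (l≤1+s : l ≤ suc s) where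

    open Cell s ρ m l 1≤m 1≤l l≤1+s

    Outside : ℕ → Set
    Outside p = ∀ a → 1 ≤ a → a ≤ s → f a ≡ p → ¬ Lower a

    Outside-image : ∀ {a} → 1 ≤ a → a ≤ s → ¬ Lower a → Outside (f a)
    Outside-image 1≤a a≤s ¬La b 1≤b b≤s fb≡fa rewrite f-injective 1≤b b≤s 1≤a a≤s fb≡fa = ¬La

    Outside-step : ∀ {u v} → InKernel n π u → Shares n π u v → Outside u →
      Infeasible s ρ m l ⊎ Outside v
    Outside-step κu (i , j , k , occ , ou , ov) out-u
      with Occ132-kernelIndices occ (member (inj₁ refl)) (member (inj₂ (inj₁ refl))) (member (inj₂ (inj₂ refl)))
      where member : ∀ {x} → OneOf x i j k → InKernel n π x
            member ox = InKernel-step κu (i , j , k , occ , ou , ox)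
    ... | a , b , c , refl , refl , refl , occ′
      with Occ132-inRange occ′ (inj₁ refl) | Occ132-inRange occ′ (inj₂ (inj₁ refl))
         | Occ132-inRange occ′ (inj₂ (inj₂ refl)) | Occ132-infeasible-or-uniform occ′
    ... | _ | _ | _ | inj₁ infeasible = inj₁ infeasible
    ... | 1≤a , a≤s | 1≤b , b≤s | 1≤c , c≤s | inj₂ (inj₁ (La , Lb , Lc)) =
      ⊥-elim (oneOf-elim {P = λ x → ¬ Outside x}
        (λ out → out a 1≤a a≤s refl La) (λ out → out b 1≤b b≤s refl Lb) (λ out → out c 1≤c c≤s refl Lc)
        ou out-u)
    ... | 1≤a , a≤s | 1≤b , b≤s | 1≤c , c≤s | inj₂ (inj₂ (¬La , ¬Lb , ¬Lc)) =
      inj₂ (oneOf-elim (Outside-image 1≤a a≤s ¬La) (Outside-image 1≤b b≤s ¬Lb) (Outside-image 1≤c c≤s ¬Lc) ov)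

    Outside-along : ∀ {u p} → InKernel n π u → Star (Shares n π) u p →
      Infeasible s ρ m l ⊎ Outside u → Infeasible s ρ m l ⊎ Outside p
    Outside-along κu u⇝p (inj₁ infeasible) = inj₁ infeasible
    Outside-along κu ε (inj₂ out) = inj₂ out
    Outside-along κu (u~v ◅ v⇝p) (inj₂ out) =
      Outside-along (InKernel-step κu u~v) v⇝p (Outside-step κu u~v out)

    Outside-maximum : ∀ {t} → π t ≡ n → Outside t
    Outside-maximum πt≡n a 1≤a a≤s refl (_ , ρa<m) =
      <⇒≱ (<-≤-trans ρa<m m≤s) (IsPerm-max ρ-perm 1≤a a≤s ρ-below)
      where
      ρ-below : ∀ b → 1 ≤ b → b ≤ s → ρ b ≤ ρ a
      ρ-below b 1≤b b≤s = ≮⇒≥ λ ρa<ρb →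
        let 1≤fb , fb≤n = InKernel-inRange (f-kernel b 1≤b b≤s)
        in <⇒≱ (subst (_< π (f b)) πt≡n (proj₁ (f-iso a b 1≤a a≤s 1≤b b≤s) ρa<ρb))
               (proj₂ (proj₁ π-perm (f b) 1≤fb fb≤n))

    Infeasible-or-Outside : ∀ {p} → InKernel n π p → Infeasible s ρ m l ⊎ Outside p
    Infeasible-or-Outside (t , 1≤t , t≤n , πt≡n , t⇝p) =
      Outside-along (t , 1≤t , t≤n , πt≡n , ε) t⇝p (inj₂ (Outside-maximum πt≡n))

lemma2 : ∀ (s : ℕ) (ρ : ℕ → ℕ) → IsKernelPerm s ρ →
    ∀ (n : ℕ) (π : ℕ → ℕ) → IsPerm n π → KernelShape n π s ρ →
    ∀ (k : ℕ) → 1 ≤ k → k ≤ s →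
    ∀ (m l : ℕ) → 1 ≤ m → m ≤ s → 1 ≤ l → l ≤ suc s →
    k < l → ρ k < m → Infeasible s ρ m l
lemma2 s ρ _ n π π-perm (ρ-perm , f , f-mono , f-kernel , f-onto , f-iso)
       k 1≤k k≤s m l 1≤m m≤s 1≤l l≤1+s k<l ρk<m
  with Infeasible-or-Outside m l 1≤m m≤s 1≤l l≤1+s (f-kernel k 1≤k k≤s)
  where open Kernel π-perm ρ-perm f f-mono f-kernel f-onto f-iso
... | inj₁ infeasible = infeasible
... | inj₂ outside = ⊥-elim (outside k 1≤k k≤s refl (k<l , ρk<m))
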